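{- Let $X\subseteq\omega$ be an infinite set with uniqueness of sums, let $u\in\beta\omega$ and let $\langle u_n : n<\omega\rangle$ be ultrafilters on $\omega$. If $u$ and each $u_n$ are $X$-adequate, then the Blass–Frolík sum $\sum_u u_n$ (an ultrafilter on $\omega\times\omega$) is Rudin–Keisler equivalent to $\bigoplus_u u_n$.
   Context: $\mathrm{FS}(A)$ is the set of sums of finite nonempty subsets of $A$. $A\subseteq\omega$ has uniqueness of sums if whenever $a_1<\dots<a_n$, $b_1<\dots<b_m$ in $A$ have equal sums, $n=m$ and $a_i=b_i$. For infinite $X\subseteq\omega$ with increasing enumeration $\langle x_n\rangle$, $A$ is $X$-adequate if $A\subseteq\mathrm{FS}(X)$ and for every subsequence $\langle x_{n_k} : k\ge1\rangle$ there is a unique $m\ge1$ with $x_{n_1}+\dots+x_{n_m}\in A$; an ultrafilter $u$ is $X$-adequate if some $X$-adequate set is in $u$ and $\mathrm{FS}(Y)\in u$ for every cofinite $Y\subseteq X$. Blass–Frolík sum: $\sum_u u_n=\{A\subseteq\omega\times\omega : \{n : \{m : (n,m)\in A\}\in u_n\}\in u\}$; $\bigoplus_u u_n$ is its image under $(n,m)\mapsto n+m$. The Rudin–Keisler image of $w$ on $S$ under $f:S\to T$ is $\{B\subseteq T : f^{ -1}[B]\in w\}$; $w\le_{RK} w'$ if $w$ is an RK image of $w'$, and $w,w'$ are RK equivalent if $w\le_{RK}w'$ and $w'\le_{RK}w$. -}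

module Defs where

open import Level using (0ℓ)
open import Data.Nat using (ℕ; zero; suc; _+_; _<_; _≤_; _≥_)
open import Data.Product using (Σ; ∃; _×_; _,_; proj₁; proj₂)
open import Data.Sum using (_⊎_)
open import Data.Unit using (⊤)
open import Data.Empty using (⊥)
open import Data.List using (List; []; _∷_)
open import Data.Nat.ListAction using (sum)
open import Data.List.Relation.Unary.All using (All)
open import Data.List.Relation.Unary.Linked using (Linked)
open import Relation.Nullary using (¬_)
open import Relation.Binary.PropositionalEquality using (_≡_)
open import Relation.Unary using (Pred; _⊆_; _∩_; ∁; _⟨→⟩_)
open import Function.Bundles using (_⇔_)

Subset : Set → Set₁
Subset S = Pred S 0ℓ

SetFamily : Set → Set₁
SetFamily S = Pred (Subset S) 0ℓ

record IsUltrafilter {S : Set} (U : SetFamily S) : Set₁ where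
  field
    full     : U (λ _ → ⊤)
    proper   : ¬ U (λ _ → ⊥)
    upward   : ∀ {A B : Subset S} → A ⊆ B → U A → U B
    inter    : ∀ {A B : Subset S} → U A → U B → U (A ∩ B)
    ultra    : ∀ (A : Subset S) → U A ⊎ U (∁ A)

record FinSub (A : Subset ℕ) : Set where
  constructor finsub
  field
    elems    : List ℕ
    nonempty : ¬ (elems ≡ [])
    incr     : Linked _<_ elems
    inA      : All A elems

FS : Subset ℕ → Subset ℕ
FS A k = Σ (FinSub A) λ F → sum (FinSub.elems F) ≡ k

UniquenessOfSums : Subset ℕ → Set
UniquenessOfSums A = ∀ (F G : FinSub A) →
  sum (FinSub.elems F) ≡ sum (FinSub.elems G) → FinSub.elems F ≡ FinSub.elems G

StrictlyIncreasing : (ℕ → ℕ) → Set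
StrictlyIncreasing s = ∀ i j → i < j → s i < s j

rangeOf : (ℕ → ℕ) → Subset ℕ
rangeOf x k = ∃ λ n → x n ≡ k

psum : (ℕ → ℕ) → ℕ → ℕ
psum s zero    = 0
psum s (suc m) = psum s m + s m

-- A is X-adequate, where X has increasing enumeration x (indexed from 0).
-- A subsequence ⟨x_{n_k}⟩ is given by a strictly increasing n : ℕ → ℕ;
-- x_{n_1}+…+x_{n_m} is psum (λ k → x (n k)) m.
Adequate : (ℕ → ℕ) → Subset ℕ → Set
Adequate x A =
  (A ⊆ FS (rangeOf x)) ×
  (∀ (n : ℕ → ℕ) → StrictlyIncreasing n →
     Σ ℕ λ m → (m ≥ 1) × A (psum (λ k → x (n k)) m) ×
       (∀ m' → m' ≥ 1 → A (psum (λ k → x (n k)) m') → m' ≡ m))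

CofiniteSubsetOf : Subset ℕ → Subset ℕ → Set
CofiniteSubsetOf Y X = (Y ⊆ X) × (∃ λ b → ∀ k → X k → ¬ Y k → k < b)

AdequateUF : (ℕ → ℕ) → SetFamily ℕ → Set₁
AdequateUF x u =
  (Σ (Subset ℕ) λ A → Adequate x A × u A) ×
  (∀ (Y : Subset ℕ) → CofiniteSubsetOf Y (rangeOf x) → u (FS Y))

RKimage : {S T : Set} → (S → T) → SetFamily S → SetFamily T
RKimage f w B = w (λ s → B (f s))

_≤RK_ : {S T : Set} → SetFamily S → SetFamily T → Set₁
_≤RK_ {S} {T} w w' = Σ (T → S) λ f → ∀ (B : Subset S) → w B ⇔ RKimage f w' B

_≡RK_ : {S T : Set} → SetFamily S → SetFamily T → Set₁
w ≡RK w' = (w ≤RK w') × (w' ≤RK w)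

BFSum : SetFamily ℕ → (ℕ → SetFamily ℕ) → SetFamily (ℕ × ℕ)
BFSum u us A = u (λ n → us n (λ m → A (n , m)))

BFPlus : SetFamily ℕ → (ℕ → SetFamily ℕ) → SetFamily ℕ
BFPlus u us = RKimage (λ p → proj₁ p + proj₂ p) (BFSum u us)

-- On the set Splits(A) = {(n , m) : n ∈ A, m ∈ FS(X ∖ [0 , n])}, which lies in Σ_u u_n as soon as
-- A ∈ u, the map (n , m) ↦ n + m is injective when A is X-adequate: writing n + m as the sum of
-- a finite set F ∪ G ⊆ X with F below G, uniqueness of sums fixes F ∪ G, and adequacy along a
-- subsequence of X running through F ∪ G singles out the initial segment F summing to n.
-- A left inverse of addition on this set, found by bounded search with u itself deciding
-- membership up to double negation, then witnesses Σ_u u_n ≤RK ⊕_u u_n.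
module Submission where

open import Defs
open import Data.Nat using (ℕ)
open import Data.Nat using (zero; suc; _+_; _∸_; _<_; _≤_; _≥_; _≟_; z≤n; s≤s; s≤s⁻¹)
open import Data.Nat.Properties
open import Data.Product using (Σ; ∃; _×_; _,_; proj₁; proj₂)
open import Data.Sum using (inj₁; inj₂; [_,_])
import Data.Sum as Sum
open import Data.Empty using (⊥-elim)
open import Data.List using (List; []; _∷_; _++_; map; length)
open import Data.List.Properties using (∷-injective; ++-conicalˡ)
open import Data.Nat.ListAction using (sum)
open import Data.Nat.ListAction.Properties using (sum-++)
open import Data.List.Relation.Unary.All using (All; []; _∷_)
import Data.List.Relation.Unary.All as All
open import Data.List.Relation.Unary.All.Properties using (++⁺)
open import Data.List.Relation.Unary.Linked using (Linked; []; [-]; _∷_)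
import Data.List.Relation.Unary.Linked as Linked
import Data.List.Relation.Unary.Linked.Properties as Linked
open import Relation.Nullary using (¬_; Dec; yes; no)
open import Relation.Nullary.Decidable using (decidable-stable)
open import Relation.Binary.PropositionalEquality using (_≡_; refl; sym; trans; cong; cong₂; subst; module ≡-Reasoning)
open import Relation.Binary.Definitions using (tri<; tri≈; tri>)
open import Relation.Unary using (_∩_)
open import Function using (_∘_; id)
open import Function.Bundles using (mk⇔)

module _ {S : Set} {w : SetFamily S} (W : IsUltrafilter w) where
  open IsUltrafilter W

  upward-within : ∀ {C P Q : Subset S} → w C → (∀ {s} → C s → P s → Q s) → w P → w Q
  upward-within wC C∩P⊆Q wP = upward (λ (c , p) → C∩P⊆Q c p) (inter wC wP)

  -- w contains exactly one of the constant sets P and ¬ P.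
  ultrafilter⇒Dec¬¬ : (P : Set) → Dec (¬ ¬ P)
  ultrafilter⇒Dec¬¬ P with ultra (λ _ → P)
  ... | inj₁ wP  = yes λ ¬p → proper (upward ¬p wP)
  ... | inj₂ w¬P = no λ ¬¬p → proper (upward ¬¬p w¬P)

  ≡RK-image : ∀ {T : Set} {C : Subset S} → w C → (f : S → T) (g : T → S) →
              (∀ {s} → C s → g (f s) ≡ s) → w ≡RK RKimage f w
  ≡RK-image wC f g g∘f≡id =
    (g , λ B → mk⇔ (upward-within wC (λ c → subst B (sym (g∘f≡id c))))
                   (upward-within wC (λ c → subst B (g∘f≡id c)))) ,
    (f , λ B → mk⇔ id id)

BFSum-isUltrafilter : ∀ {u us} → IsUltrafilter u → (∀ n → IsUltrafilter (us n)) →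
                      IsUltrafilter (BFSum u us)
BFSum-isUltrafilter {u} {us} U Us = record
  { full   = U.upward (λ {n} _ → Us.full n) U.full
  ; proper = λ h → U.proper (U.upward (λ {n} → Us.proper n) h)
  ; upward = λ A⊆B → U.upward (λ {n} → Us.upward n A⊆B)
  ; inter  = λ hA hB → U.upward (λ {n} (a , b) → Us.inter n a b) (U.inter hA hB)
  ; ultra  = λ A → Sum.map id
      (U.upward (λ {n} ¬A → [ ⊥-elim ∘ ¬A , id ] (Us.ultra n (λ m → A (n , m)))))
      (U.ultra (λ n → us n (λ m → A (n , m))))
  }
  where
  module U = IsUltrafilter U
  module Us n = IsUltrafilter (Us n)

+-leftInverseOn : ((P : Set) → Dec (¬ ¬ P)) → (C : Subset (ℕ × ℕ)) →
  (∀ {n m n' m'} → C (n , m) → C (n' , m') → n + m ≡ n' + m' → n ≡ n') →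
  Σ (ℕ → ℕ × ℕ) λ g → ∀ {p} → C p → g (proj₁ p + proj₂ p) ≡ p
+-leftInverseOn dec¬¬ C +-inj = g , λ {(n , m)} → g∘+≡id n m
  where
  g : ℕ → ℕ × ℕ
  g k with anyUpTo? (λ i → dec¬¬ (C (i , k ∸ i))) (suc k)
  ... | yes (i , _ , _) = i , k ∸ i
  ... | no _            = 0 , k

  g∘+≡id : ∀ n m → C (n , m) → g (n + m) ≡ (n , m)
  g∘+≡id n m c with anyUpTo? (λ i → dec¬¬ (C (i , n + m ∸ i))) (suc (n + m))
  ... | yes (i , i<k , ¬¬ci) =
    trans (cong (λ j → j , n + m ∸ j) i≡n) (cong (n ,_) (m+n∸m≡n n m))
    where
    i≡n : i ≡ n
    i≡n = decidable-stable (i ≟ n)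
      λ i≢n → ¬¬ci λ ci → i≢n (+-inj ci c (m+[n∸m]≡n (s≤s⁻¹ i<k)))
  ... | no none = ⊥-elim (none (n , s≤s (m≤m+n n m) ,
                                λ ¬c → ¬c (subst (λ k → C (n , k)) (sym (m+n∸m≡n n m)) c)))

All-≤-sum : (ns : List ℕ) → All (_≤ sum ns) ns
All-≤-sum []       = []
All-≤-sum (n ∷ ns) = m≤m+n n (sum ns) ∷ All.map (λ k≤ → ≤-trans k≤ (m≤n+m (sum ns) n)) (All-≤-sum ns)

Linked-++-separated : ∀ {n xs ys} → Linked _<_ xs → Linked _<_ ys →
                      All (_≤ n) xs → All (n <_) ys → Linked _<_ (xs ++ ys)
Linked-++-separated []           lys _            _            = lys
Linked-++-separated [-]          []  _            _            = [-]
Linked-++-separated [-]          lys (x≤n ∷ [])   (n<y ∷ _)    = ≤-<-trans x≤n n<y ∷ lys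
Linked-++-separated (x<x' ∷ lxs) lys (_ ∷ xs≤n)   n<ys         =
  x<x' ∷ Linked-++-separated lxs lys xs≤n n<ys

map-preimage : ∀ {A B : Set} (f : A → B) {bs : List B} →
               All (λ b → ∃ λ a → f a ≡ b) bs → ∃ λ as → map f as ≡ bs
map-preimage f []               = [] , refl
map-preimage f ((a , refl) ∷ h) with map-preimage f h
... | as , refl = a ∷ as , refl

StrictlyIncreasing⇒<-reflect : ∀ {x} → StrictlyIncreasing x → ∀ {i j} → x i < x j → i < j
StrictlyIncreasing⇒<-reflect x↑ {i} {j} xi<xj with <-cmp i j
... | tri< i<j _ _ = i<j
... | tri≈ _ refl _ = ⊥-elim (<-irrefl refl xi<xj)
... | tri> _ _ j<i = ⊥-elim (<-asym xi<xj (x↑ j i j<i))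

StrictlyIncreasing-step : ∀ {s} → (∀ k → s k < s (suc k)) → StrictlyIncreasing s
StrictlyIncreasing-step s↑ i (suc j) i<1+j with m≤n⇒m<n∨m≡n (s≤s⁻¹ i<1+j)
... | inj₁ i<j  = <-trans (StrictlyIncreasing-step s↑ i j i<j) (s↑ j)
... | inj₂ refl = s↑ i

extend : ℕ → List ℕ → ℕ → ℕ
extend b []       k       = b + k
extend b (j ∷ js) zero    = j
extend b (j ∷ js) (suc k) = extend (suc j) js k

extend-step : ∀ b {js} → Linked _<_ js → ∀ k → extend b js k < extend b js (suc k)
extend-step b []            k       = +-monoʳ-< b (n<1+n k)
extend-step b {j ∷ []} [-]  zero    = s≤s (m≤m+n j 0)
extend-step b {j ∷ []} [-]  (suc k) = extend-step (suc j) [] k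
extend-step b (j<j' ∷ _)    zero    = j<j'
extend-step b {j ∷ _} (_ ∷ ljs) (suc k) = extend-step (suc j) ljs k

psum-suc : ∀ s m → psum s (suc m) ≡ s 0 + psum (s ∘ suc) m
psum-suc s zero    = sym (+-identityʳ (s 0))
psum-suc s (suc m) = trans (cong (_+ s (suc m)) (psum-suc s m))
                           (+-assoc (s 0) (psum (s ∘ suc) m) (s (suc m)))

psum-extend-++ : ∀ (f : ℕ → ℕ) b js (F G : List ℕ) → map f js ≡ F ++ G →
                 psum (f ∘ extend b js) (length F) ≡ sum F
psum-extend-++ f b js       []      G eq = refl
psum-extend-++ f b (j ∷ js) (a ∷ F) G eq
  with fj≡a , eq' ← ∷-injective eq =
  trans (psum-suc (f ∘ extend b (j ∷ js)) (length F))
        (cong₂ _+_ fj≡a (psum-extend-++ f (suc j) js F G eq'))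

subsequence-through : ∀ {x} → StrictlyIncreasing x → (H : FinSub (rangeOf x)) →
  Σ (ℕ → ℕ) λ s → StrictlyIncreasing s ×
    (∀ F G → FinSub.elems H ≡ F ++ G → psum (x ∘ s) (length F) ≡ sum F)
subsequence-through {x} x↑ H with map-preimage x (FinSub.inA H)
... | js , xjs≡H = extend 0 js ,
  StrictlyIncreasing-step (extend-step 0 js↑) ,
  λ F G H≡FG → psum-extend-++ x 0 js F G (trans xjs≡H H≡FG)
  where
  js↑ : Linked _<_ js
  js↑ = Linked.map (StrictlyIncreasing⇒<-reflect x↑)
          (Linked.map⁻ (subst (Linked _<_) (sym xjs≡H) (FinSub.incr H)))

++-FinSub : ∀ {P : Subset ℕ} {n} (F : FinSub P) → All (_≤ n) (FinSub.elems F) →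
            FinSub (P ∩ (n <_)) → FinSub P
++-FinSub (finsub F neF F↑ F∈P) F≤n (finsub G _ G↑ G∈P∩) = finsub (F ++ G)
  (neF ∘ ++-conicalˡ F G)
  (Linked-++-separated F↑ G↑ F≤n (All.map proj₂ G∈P∩))
  (++⁺ F∈P (All.map proj₁ G∈P∩))

FinSub-length≥1 : ∀ {P} (F : FinSub P) → length (FinSub.elems F) ≥ 1
FinSub-length≥1 (finsub []      ne _ _) = ⊥-elim (ne refl)
FinSub-length≥1 (finsub (_ ∷ _) _  _ _) = s≤s z≤n

Adequate-length-unique : ∀ {x A} → Adequate x A → ∀ {s} → StrictlyIncreasing s →
  ∀ {a b} → a ≥ 1 → b ≥ 1 → A (psum (x ∘ s) a) → A (psum (x ∘ s) b) → a ≡ b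
Adequate-length-unique (_ , adequate) s↑ a≥1 b≥1 Aa Ab
  with _ , _ , _ , unique ← adequate _ s↑ = trans (unique _ a≥1 Aa) (sym (unique _ b≥1 Ab))

Adequate-prefix-unique : ∀ {x A} → StrictlyIncreasing x → Adequate x A → (H : FinSub (rangeOf x)) →
  ∀ {E R E' R'} → FinSub.elems H ≡ E ++ R → FinSub.elems H ≡ E' ++ R' →
  length E ≥ 1 → length E' ≥ 1 → A (sum E) → A (sum E') → sum E ≡ sum E'
Adequate-prefix-unique {x} {A} x↑ adA H {E} {R} {E'} {R'} H≡ER H≡E'R' |E|≥1 |E'|≥1 AE AE'
  with s , s↑ , psum-prefix ← subsequence-through x↑ H =
  begin
    sum E                    ≡⟨ psum-E ⟨
    psum (x ∘ s) (length E)  ≡⟨ cong (psum (x ∘ s)) |E|≡|E'| ⟩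
    psum (x ∘ s) (length E') ≡⟨ psum-E' ⟩
    sum E'                   ∎
  where
  open ≡-Reasoning
  psum-E : psum (x ∘ s) (length E) ≡ sum E
  psum-E = psum-prefix E R H≡ER
  psum-E' : psum (x ∘ s) (length E') ≡ sum E'
  psum-E' = psum-prefix E' R' H≡E'R'
  |E|≡|E'| : length E ≡ length E'
  |E|≡|E'| = Adequate-length-unique adA s↑ |E|≥1 |E'|≥1
               (subst A (sym psum-E) AE) (subst A (sym psum-E') AE')

rangeAbove : (ℕ → ℕ) → ℕ → Subset ℕ
rangeAbove x n = rangeOf x ∩ (n <_)

rangeAbove-cofinite : ∀ x n → CofiniteSubsetOf (rangeAbove x n) (rangeOf x)
rangeAbove-cofinite x n =
  proj₁ , suc n , λ k k∈X k∉above → s≤s (≮⇒≥ λ n<k → k∉above (k∈X , n<k))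

Splits : (ℕ → ℕ) → Subset ℕ → Subset (ℕ × ℕ)
Splits x A (n , m) = A n × FS (rangeAbove x n) m

Splits∈BFSum : ∀ {x A u us} → IsUltrafilter u → (∀ n → IsUltrafilter (us n)) →
  u A → (∀ n → AdequateUF x (us n)) → BFSum u us (Splits x A)
Splits∈BFSum {x} U Us uA adUs = IsUltrafilter.upward U
  (λ {n} An → IsUltrafilter.upward (Us n) (An ,_)
                (proj₂ (adUs n) (rangeAbove x n) (rangeAbove-cofinite x n)))
  uA

Splits-+-injective : ∀ {x A} → StrictlyIncreasing x → UniquenessOfSums (rangeOf x) → Adequate x A →
  ∀ {n m n' m'} → Splits x A (n , m) → Splits x A (n' , m') → n + m ≡ n' + m' → n ≡ n'
Splits-+-injective {x} {A} x↑ uos adA {n} {m} {n'} {m'} (An , G , ΣG≡m) (An' , G' , ΣG'≡m') n+m≡n'+m'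
  with F , ΣF≡n ← proj₁ adA An | F' , ΣF'≡n' ← proj₁ adA An' =
  begin
    n              ≡⟨ ΣF≡n ⟨
    sum (elems F)  ≡⟨ Adequate-prefix-unique x↑ adA FG {R = elems G} {R' = elems G'} refl FG≡F'G'
                        (FinSub-length≥1 F) (FinSub-length≥1 F')
                        (subst A (sym ΣF≡n) An) (subst A (sym ΣF'≡n') An') ⟩
    sum (elems F') ≡⟨ ΣF'≡n' ⟩
    n'             ∎
  where
  open ≡-Reasoning
  open FinSub using (elems)

  FG : FinSub (rangeOf x)
  FG = ++-FinSub F (subst (λ k → All (_≤ k) (elems F)) ΣF≡n (All-≤-sum (elems F))) G
  F'G' : FinSub (rangeOf x)
  F'G' = ++-FinSub F' (subst (λ k → All (_≤ k) (elems F')) ΣF'≡n' (All-≤-sum (elems F'))) G'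

  FG≡F'G' : elems FG ≡ elems F' ++ elems G'
  FG≡F'G' = uos FG F'G' (begin
    sum (elems F ++ elems G)   ≡⟨ trans (sum-++ (elems F) _) (cong₂ _+_ ΣF≡n ΣG≡m) ⟩
    n + m                      ≡⟨ n+m≡n'+m' ⟩
    n' + m'                    ≡⟨ trans (sum-++ (elems F') _) (cong₂ _+_ ΣF'≡n' ΣG'≡m') ⟨
    sum (elems F' ++ elems G') ∎)

proposition2p13 : (x : ℕ → ℕ) → StrictlyIncreasing x →
    UniquenessOfSums (rangeOf x) →
    (u : SetFamily ℕ) → IsUltrafilter u →
    (us : ℕ → SetFamily ℕ) → (∀ n → IsUltrafilter (us n)) →
    AdequateUF x u → (∀ n → AdequateUF x (us n)) →
    BFSum u us ≡RK BFPlus u us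
proposition2p13 x x↑ uos u U us Us ((A , adA , uA) , _) adUs
  with g , g∘+≡id ← +-leftInverseOn (ultrafilter⇒Dec¬¬ U) (Splits x A) (Splits-+-injective x↑ uos adA) =
  ≡RK-image (BFSum-isUltrafilter U Us) (Splits∈BFSum U Us uA adUs) _ g g∘+≡id
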